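{- Let $\Gamma=(V,E,\mathbf I)$ be a connected locally finite graph with $E\neq\emptyset$, and let $G\le\mathrm{Aut}\,\Gamma$ be such that $\Gamma$ is $G$-vertex-rotary with valency $k$ and edge-multiplicity $\lambda$. Let $\alpha,\beta$ be adjacent vertices, $e$ an edge incident with $\alpha$ and $\beta$, $H=G_\alpha$ and $J=G_e$. Then: (a) $\Gamma\cong\mathrm{Cos}(G,H,J)$, and there are $a,z\in G$ with $G=\langle a,z\rangle$, $H=\langle a\rangle\cong\mathbb Z_{k\lambda}$, $H\cap H^z=\langle a^k\rangle\cong\mathbb Z_\lambda$, $J=\langle z\rangle\cong\mathbb Z_2$, and $H\cap J=1$; (b) $z,z^a\notin\langle a\rangle$, $(a,z)$ is a rotary pair for $G$, and $G$ acts regularly on the arc set of $\Gamma$.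
   Context: A graph is a triple $(V,E,\mathbf I)$, $\mathbf I\subseteq V\times E$, each edge incident with exactly two distinct vertices (multiple edges allowed, no loops); $E(\alpha)$ = edges incident with $\alpha$; locally finite if all $E(\alpha)$ finite. Valency $k$: each vertex has exactly $k$ neighbours; edge-multiplicity $\lambda$: each adjacent pair is incident with exactly $\lambda$ common edges. Arcs: edges with an ordering of their two vertices. $\Gamma$ is $G$-vertex-rotary ($G\le\mathrm{Aut}\,\Gamma$) if $G$ is transitive on arcs and the vertex stabiliser $G_\alpha$ induces a transitive cyclic group on $E(\alpha)$. For subgroups $H,J\le G$, $\mathrm{Cos}(G,H,J)$ has vertex set $[G:H]$, edge set $[G:J]$ (right cosets), $Hx$ incident with $Jy$ iff $yx^{ -1}\in JH$. A rotary pair for $G$ is $(a,z)$ with $G=\langle a,z\rangle$, $|a|$ finite, $|z|=2$, $z\notin\langle a\rangle$. $H^z=z^{ -1}Hz$, $z^a=a^{ -1}za$. -}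

module Defs where

open import Level using (Level; _⊔_) renaming (suc to lsuc)
open import Data.Nat using (ℕ; zero; suc; _<_)
open import Data.Integer using (ℤ; +_; -[1+_])
open import Data.Fin using (Fin)
open import Data.Product using (Σ; ∃; _×_; _,_; ∃-syntax)
open import Data.Sum using (_⊎_)
open import Relation.Binary.PropositionalEquality using (_≡_)
open import Relation.Nullary using (¬_)
open import Function.Bundles using (_⇔_)
open import Function.Definitions using (Injective)
open import Algebra.Bundles using (Group)

-- Graphs (V, E, I): I ⊆ V × E, each edge incident with exactly two
-- distinct vertices (multiple edges allowed, no loops).

record Graph (a : Level) : Set (lsuc a) where
  field
    V : Set a
    E : Set a
    I : V → E → Set a
    two-ends : ∀ e → ∃[ u ] ∃[ v ]
      (¬ u ≡ v × I u e × I v e × (∀ w → I w e → w ≡ u ⊎ w ≡ v))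

HasSize : ∀ {a b} {A : Set a} → (A → Set b) → ℕ → Set (a ⊔ b)
HasSize {A = A} P n =
  Σ (Fin n → A) λ f → Injective _≡_ _≡_ f × (∀ x → P x ⇔ (∃[ i ] f i ≡ x))

module GraphNotions {a : Level} (Γ : Graph a) where
  open Graph Γ

  Adjacent : V → V → Set a
  Adjacent α β = ¬ α ≡ β × ∃[ e ] (I α e × I β e)

  data Connected : V → V → Set a where
    here : ∀ {α} → Connected α α
    step : ∀ {α β γ e} → I α e → I β e → Connected β γ → Connected α γ

  IsConnected : Set a
  IsConnected = ∀ α β → Connected α β

  LocallyFinite : Set a
  LocallyFinite = ∀ α → ∃[ n ] HasSize (I α) n

  HasValency : ℕ → Set a
  HasValency k = ∀ α → HasSize (Adjacent α) k

  HasEdgeMultiplicity : ℕ → Set a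
  HasEdgeMultiplicity m =
    ∀ α β → Adjacent α β → HasSize (λ e → I α e × I β e) m

  record Arc : Set a where
    field
      edge : E
      tail : V
      head : V
      distinct : ¬ tail ≡ head
      tail-inc : I tail edge
      head-inc : I head edge

module GroupNotions {c ℓ : Level} (G : Group c ℓ) where
  open Group G

  powℕ : Carrier → ℕ → Carrier
  powℕ g zero = ε
  powℕ g (suc n) = g ∙ powℕ g n

  pow : Carrier → ℤ → Carrier
  pow g (+ n) = powℕ g n
  pow g -[1+ n ] = (powℕ g (suc n)) ⁻¹

  Cyc : Carrier → Carrier → Set ℓ
  Cyc x g = ∃[ n ] g ≈ pow x n

  HasOrder : Carrier → ℕ → Set ℓ
  HasOrder x n = 0 < n × powℕ x n ≈ ε × (∀ m → 0 < m → m < n → ¬ powℕ x m ≈ ε)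

  data Gen (x y : Carrier) : Carrier → Set (c ⊔ ℓ) where
    gen-x : Gen x y x
    gen-y : Gen x y y
    gen-ε : Gen x y ε
    gen-∙ : ∀ {g h} → Gen x y g → Gen x y h → Gen x y (g ∙ h)
    gen-⁻¹ : ∀ {g} → Gen x y g → Gen x y (g ⁻¹)
    gen-≈ : ∀ {g h} → g ≈ h → Gen x y g → Gen x y h

  Generates : Carrier → Carrier → Set (c ⊔ ℓ)
  Generates x y = ∀ g → Gen x y g

  RotaryPair : Carrier → Carrier → Set (c ⊔ ℓ)
  RotaryPair x y = (∃[ n ] HasOrder x n) × HasOrder y 2 × ¬ Cyc x y × Generates x y

-- G ≤ Aut Γ : a faithful (right) action of G on Γ by automorphisms,
-- α^(g h) = (α^g)^h.

record AutAction {a c ℓ : Level} (G : Group c ℓ) (Γ : Graph a) : Set (a ⊔ c ⊔ ℓ) where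
  open Group G
  open Graph Γ
  field
    actV : Carrier → V → V
    actE : Carrier → E → E
    actV-ε : ∀ v → actV ε v ≡ v
    actE-ε : ∀ e → actE ε e ≡ e
    actV-∙ : ∀ g h v → actV (g ∙ h) v ≡ actV h (actV g v)
    actE-∙ : ∀ g h e → actE (g ∙ h) e ≡ actE h (actE g e)
    actV-resp : ∀ {g h} → g ≈ h → ∀ v → actV g v ≡ actV h v
    actE-resp : ∀ {g h} → g ≈ h → ∀ e → actE g e ≡ actE h e
    preserves-I : ∀ g v e → I v e ⇔ I (actV g v) (actE g e)
    faithful : ∀ g → (∀ v → actV g v ≡ v) → (∀ e → actE g e ≡ e) → g ≈ ε

module ActionNotions {a c ℓ : Level} {G : Group c ℓ} {Γ : Graph a}
                     (A : AutAction G Γ) where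
  open Group G
  open Graph Γ
  open GraphNotions Γ
  open GroupNotions G
  open AutAction A
  open Arc

  MapsArc : Carrier → Arc → Arc → Set a
  MapsArc g x y = actE g (edge x) ≡ edge y × actV g (tail x) ≡ tail y
                  × actV g (head x) ≡ head y

  ArcTransitive : Set (a ⊔ c)
  ArcTransitive = ∀ x y → ∃[ g ] MapsArc g x y

  ArcRegular : Set (a ⊔ c ⊔ ℓ)
  ArcRegular = ArcTransitive × (∀ x g → MapsArc g x x → g ≈ ε)

  -- G_α induces a transitive cyclic group on E(α)
  LocallyCyclicTransitive : V → Set (a ⊔ c)
  LocallyCyclicTransitive α =
    (∃[ h ] (actV h α ≡ α × (∀ g → actV g α ≡ α →
        ∃[ n ] (∀ e → I α e → actE g e ≡ actE (pow h n) e))))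
    × (∀ e e' → I α e → I α e' → ∃[ g ] (actV g α ≡ α × actE g e ≡ e'))

  VertexRotary : Set (a ⊔ c)
  VertexRotary = ArcTransitive × (∀ α → LocallyCyclicTransitive α)

  Prod : (Carrier → Set a) → (Carrier → Set a) → Carrier → Set (a ⊔ c ⊔ ℓ)
  Prod P Q g = ∃[ j ] ∃[ h ] (P j × Q h × g ≈ j ∙ h)

  -- Γ ≅ Cos(G, H, J): vertices of Cos are right cosets H x (represented by
  -- x, with H x = H y iff x y⁻¹ ∈ H), edges are right cosets J y, and
  -- H x is incident with J y iff y x⁻¹ ∈ J H.  An isomorphism is given by
  -- maps on representatives that are well defined and injective on
  -- cosets, surjective, and preserve incidence in both directions.
  IsoCos : (Carrier → Set a) → (Carrier → Set a) → Set (a ⊔ c ⊔ ℓ)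
  IsoCos H J =
    Σ (Carrier → V) λ fV → Σ (Carrier → E) λ fE →
      (∀ x y → fV x ≡ fV y ⇔ H (x ∙ y ⁻¹))
      × (∀ x y → fE x ≡ fE y ⇔ J (x ∙ y ⁻¹))
      × (∀ v → ∃[ x ] fV x ≡ v)
      × (∀ e → ∃[ y ] fE y ≡ e)
      × (∀ x y → I (fV x) (fE y) ⇔ Prod J H (y ∙ x ⁻¹))

-- G_α acts on the star E(α) as a transitive cyclic, hence regular, group, so an
-- element fixing a vertex and an edge at it fixes the whole star; by connectivity
-- it is the identity, i.e. G acts regularly on arcs.  The generator x of G_α
-- therefore permutes the kλ edges at α in a single cycle, so |x| = kλ, and its
-- action on the k neighbours of α has kernel ⟨x^k⟩ = G_α ∩ G_β.  The element z
-- reversing the arc (α, β) through e is an involution generating G_e, and since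
-- ⟨x, z⟩ reaches every neighbour of α, connectivity gives G = ⟨x, z⟩.
module Submission where

open import Defs
open import Level using (Level; _⊔_)
open import Data.Nat
  using (ℕ; zero; suc; _+_; _*_; _∸_; _<_; _≤_; _>_; s≤s; z<s; s≤s⁻¹; NonZero; >-nonZero; >-nonZero⁻¹)
open import Data.Nat.Properties
  using (*-suc; *-zeroʳ; *-comm; +-comm; m∸n+n≡m; m∸n≤m; <⇒≤; <⇒≱; m≤n⇒m<n∨m≡n; ≤-trans; n<1+n; m<n⇒0<n∸m;
         *-monoʳ-<; m*n≢0; m*n≢0⇒m≢0; m*n≢0⇒n≢0)
open import Data.Nat.DivMod using (_%_; _/_; m≡m%n+[m/n]*n; m%n<n)
open import Data.Nat.Divisibility using (_∣_; divides; m%n≡0⇒n∣m)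
open import Data.Integer using (+_; -[1+_])
open import Data.Fin using (Fin; toℕ; fromℕ<; combine; remQuot)
open import Data.Fin.Properties
  using (pigeonhole; injective⇒≤; toℕ<n; toℕ-fromℕ<; nonZeroIndex; combine-remQuot; remQuot-combine)
open import Data.Product using (_×_; _,_; ∃-syntax; proj₁; proj₂; uncurry)
open import Data.Sum using (_⊎_; inj₁; inj₂)
open import Data.Empty using (⊥-elim)
import Relation.Binary.PropositionalEquality as ≡
open ≡ using (_≡_; cong; subst; subst₂)
open import Relation.Nullary using (¬_)
open import Function.Bundles using (_⇔_; mk⇔; Equivalence)
open import Function.Definitions using (Injective)
open import Algebra.Bundles using (Group)

open Equivalence using (to; from)

-- Iterated maps and finite orbits

iterate : ∀ {a} {X : Set a} → (X → X) → ℕ → X → X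
iterate t zero    x = x
iterate t (suc n) x = iterate t n (t x)

module _ {a} {X : Set a} (t : X → X) where
  open ≡ using (sym; trans)

  iterate-+ : ∀ i j x → iterate t (i + j) x ≡ iterate t j (iterate t i x)
  iterate-+ zero    j x = ≡.refl
  iterate-+ (suc i) j x = iterate-+ i j (t x)

  iterate-injective : (∀ {x y} → t x ≡ t y → x ≡ y) →
                      ∀ n {x y} → iterate t n x ≡ iterate t n y → x ≡ y
  iterate-injective t-injective zero    eq = eq
  iterate-injective t-injective (suc n) eq = t-injective (iterate-injective t-injective n eq)

  iterate-preserves : ∀ {b} (P : X → Set b) → (∀ {x} → P x → P (t x)) →
                      ∀ n {x} → P x → P (iterate t n x)
  iterate-preserves P t-preserves zero    Px = Px
  iterate-preserves P t-preserves (suc n) Px = iterate-preserves P t-preserves n (t-preserves Px)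

  module _ (d : ℕ) {p : X} (returns : iterate t d p ≡ p) where

    iterate-multiple : ∀ q → iterate t (q * d) p ≡ p
    iterate-multiple zero    = ≡.refl
    iterate-multiple (suc q) = trans (iterate-+ d (q * d) p)
      (trans (cong (iterate t (q * d)) returns) (iterate-multiple q))

    iterate-% : .{{_ : NonZero d}} → ∀ r → iterate t (r % d) p ≡ iterate t r p
    iterate-% r = begin
      iterate t (r % d) p
        ≡⟨ cong (iterate t (r % d)) (iterate-multiple (r / d)) ⟨
      iterate t (r % d) (iterate t (r / d * d) p)
        ≡⟨ iterate-+ (r / d * d) (r % d) p ⟨
      iterate t (r / d * d + r % d) p
        ≡⟨ cong (λ n → iterate t n p) (trans (+-comm (r / d * d) (r % d)) (sym (m≡m%n+[m/n]*n r d))) ⟩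
      iterate t r p
        ∎
      where open ≡.≡-Reasoning

module FiniteOrbit {a b} {X : Set a} {P : X → Set b} {K : ℕ} (size : HasSize P K)
                   (t : X → X) (t-injective : ∀ {x y} → t x ≡ t y → x ≡ y)
                   (t-preserves : ∀ {x} → P x → P (t x)) {p : X} (Pp : P p) where
  open ≡ using (sym; trans)

  private
    enum : Fin K → X
    enum = proj₁ size

    enum-injective : Injective _≡_ _≡_ enum
    enum-injective = proj₁ (proj₂ size)

    index : ∀ {y} → P y → Fin K
    index {y} Py = proj₁ (to (proj₂ (proj₂ size) y) Py)

    enum-index : ∀ {y} (Py : P y) → enum (index Py) ≡ y
    enum-index {y} Py = proj₂ (to (proj₂ (proj₂ size) y) Py)

    enum-∈ : ∀ i → P (enum i)
    enum-∈ i = from (proj₂ (proj₂ size) (enum i)) (i , ≡.refl)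

    iterate-∈ : ∀ n → P (iterate t n p)
    iterate-∈ n = iterate-preserves t P t-preserves n Pp

  size>0 : K > 0
  size>0 = >-nonZero⁻¹ K {{nonZeroIndex (index Pp)}}

  return-time : ∃[ d ] (d > 0 × d ≤ K × iterate t d p ≡ p)
  return-time with pigeonhole (n<1+n K) (λ i → index (iterate-∈ (toℕ i)))
  ... | i , j , i<j , same-index =
    d , m<n⇒0<n∸m i<j , ≤-trans (m∸n≤m (toℕ j) (toℕ i)) (s≤s⁻¹ (toℕ<n j)) , returns
    where
      open ≡.≡-Reasoning
      d : ℕ
      d = toℕ j ∸ toℕ i
      returns : iterate t d p ≡ p
      returns = sym (iterate-injective t t-injective (toℕ i) (begin
        iterate t (toℕ i) p                ≡⟨ enum-index (iterate-∈ (toℕ i)) ⟨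
        enum (index (iterate-∈ (toℕ i)))   ≡⟨ cong enum same-index ⟩
        enum (index (iterate-∈ (toℕ j)))   ≡⟨ enum-index (iterate-∈ (toℕ j)) ⟩
        iterate t (toℕ j) p                ≡⟨ cong (λ n → iterate t n p) (m∸n+n≡m (<⇒≤ i<j)) ⟨
        iterate t (d + toℕ i) p            ≡⟨ iterate-+ t d (toℕ i) p ⟩
        iterate t (toℕ i) (iterate t d p)  ∎))

  module Transitive (reach : ∀ {y} → P y → ∃[ r ] iterate t r p ≡ y) where

    private instance
      K≢0 : NonZero K
      K≢0 = >-nonZero size>0

    orbit-aperiodic : ∀ {d} → d > 0 → d < K → ¬ iterate t d p ≡ p
    orbit-aperiodic {d} d>0 d<K returns = <⇒≱ d<K (injective⇒≤ residue-injective)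
      where
        instance
          d≢0 : NonZero d
          d≢0 = >-nonZero d>0

        exponent : Fin K → ℕ
        exponent i = proj₁ (reach (enum-∈ i))

        residue : Fin K → Fin d
        residue i = fromℕ< (m%n<n (exponent i) d)

        iterate-residue : ∀ i → iterate t (toℕ (residue i)) p ≡ enum i
        iterate-residue i = trans (cong (λ n → iterate t n p) (toℕ-fromℕ< (m%n<n (exponent i) d)))
          (trans (iterate-% t d returns (exponent i)) (proj₂ (reach (enum-∈ i))))

        residue-injective : Injective _≡_ _≡_ residue
        residue-injective {i} {j} eq = enum-injective (trans (sym (iterate-residue i))
          (trans (cong (λ s → iterate t (toℕ s) p) eq) (iterate-residue j)))

    orbit-period : iterate t K p ≡ p
    orbit-period with return-time
    ... | d , d>0 , d≤K , returns with m≤n⇒m<n∨m≡n d≤K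
    ...   | inj₁ d<K   = ⊥-elim (orbit-aperiodic d>0 d<K returns)
    ...   | inj₂ ≡.refl = returns

    period-divides : ∀ r → iterate t r p ≡ p → K ∣ r
    period-divides r returns with r % K in eq
    ... | zero  = m%n≡0⇒n∣m r K eq
    ... | suc s = ⊥-elim (orbit-aperiodic z<s (subst (_< K) eq (m%n<n r K))
                    (subst (λ n → iterate t n p ≡ p) eq (trans (iterate-% t K orbit-period r) returns)))

-- Powers in a group

module GroupPowers {c ℓ} (G : Group c ℓ) where
  open Group G
  open GroupNotions G
  open import Algebra.Properties.Group G using (∙-cancelˡ; //-rightDividesʳ; \\-leftDividesˡ; inverseʳ-unique)
  open import Relation.Binary.Reasoning.Setoid setoid

  powℕ-+ : ∀ g i j → powℕ g (i + j) ≈ powℕ g i ∙ powℕ g j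
  powℕ-+ g zero    j = sym (identityˡ _)
  powℕ-+ g (suc i) j = trans (∙-congˡ (powℕ-+ g i j)) (sym (assoc _ _ _))

  powℕ-* : ∀ g i j → powℕ (powℕ g i) j ≈ powℕ g (i * j)
  powℕ-* g i zero    = reflexive (cong (powℕ g) (≡.sym (*-zeroʳ i)))
  powℕ-* g i (suc j) = begin
    powℕ g i ∙ powℕ (powℕ g i) j  ≈⟨ ∙-congˡ (powℕ-* g i j) ⟩
    powℕ g i ∙ powℕ g (i * j)     ≈⟨ powℕ-+ g i (i * j) ⟨
    powℕ g (i + i * j)            ≡⟨ cong (powℕ g) (*-suc i j) ⟨
    powℕ g (i * suc j)            ∎

  powℕ-multiple : ∀ {g d} → powℕ g d ≈ ε → ∀ q → powℕ g (d * q) ≈ ε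
  powℕ-multiple {g} {d} gᵈ≈ε zero    = reflexive (cong (powℕ g) (*-zeroʳ d))
  powℕ-multiple {g} {d} gᵈ≈ε (suc q) = begin
    powℕ g (d * suc q)         ≡⟨ cong (powℕ g) (*-suc d q) ⟩
    powℕ g (d + d * q)         ≈⟨ powℕ-+ g d (d * q) ⟩
    powℕ g d ∙ powℕ g (d * q)  ≈⟨ ∙-cong gᵈ≈ε (powℕ-multiple {g} {d} gᵈ≈ε q) ⟩
    ε ∙ ε                      ≈⟨ identityˡ ε ⟩
    ε                          ∎

  pow≈powℕ : ∀ {g d} → d > 0 → powℕ g d ≈ ε → ∀ n → ∃[ r ] pow g n ≈ powℕ g r
  pow≈powℕ             _ _    (+ n)    = n , refl
  pow≈powℕ {g} {suc d} _ gᵈ≈ε -[1+ n ] = d * suc n , sym (inverseʳ-unique (powℕ g (suc n)) _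
    (trans (sym (powℕ-+ g (suc n) (d * suc n))) (powℕ-multiple {g} {suc d} gᵈ≈ε (suc n))))

  commute-⁻¹ : ∀ {g h} → g ∙ h ≈ h ∙ g → g ∙ h ⁻¹ ≈ h ⁻¹ ∙ g
  commute-⁻¹ {g} {h} gh≈hg = ∙-cancelˡ h _ _ (begin
    h ∙ (g ∙ h ⁻¹)  ≈⟨ assoc h g (h ⁻¹) ⟨
    h ∙ g ∙ h ⁻¹    ≈⟨ ∙-congʳ gh≈hg ⟨
    g ∙ h ∙ h ⁻¹    ≈⟨ //-rightDividesʳ h g ⟩
    g               ≈⟨ \\-leftDividesˡ h g ⟨
    h ∙ (h ⁻¹ ∙ g)  ∎)

  commute-powℕ : ∀ {g h} → g ∙ h ≈ h ∙ g → ∀ n → g ∙ powℕ h n ≈ powℕ h n ∙ g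
  commute-powℕ {g} {h} gh≈hg zero    = trans (identityʳ g) (sym (identityˡ g))
  commute-powℕ {g} {h} gh≈hg (suc n) = begin
    g ∙ (h ∙ powℕ h n)  ≈⟨ assoc g h (powℕ h n) ⟨
    g ∙ h ∙ powℕ h n    ≈⟨ ∙-congʳ gh≈hg ⟩
    h ∙ g ∙ powℕ h n    ≈⟨ assoc h g (powℕ h n) ⟩
    h ∙ (g ∙ powℕ h n)  ≈⟨ ∙-congˡ (commute-powℕ gh≈hg n) ⟩
    h ∙ (powℕ h n ∙ g)  ≈⟨ assoc h (powℕ h n) g ⟨
    h ∙ powℕ h n ∙ g    ∎

  commute-pow : ∀ {g h} → g ∙ h ≈ h ∙ g → ∀ n → g ∙ pow h n ≈ pow h n ∙ g
  commute-pow gh≈hg (+ n)    = commute-powℕ gh≈hg n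
  commute-pow gh≈hg -[1+ n ] = commute-⁻¹ (commute-powℕ gh≈hg (suc n))

  pow-commute : ∀ h m n → pow h m ∙ pow h n ≈ pow h n ∙ pow h m
  pow-commute h m n = sym (commute-pow (sym (commute-pow refl n)) m)

  powℕ-hasOrder : ∀ {g} k m → HasOrder g (k * m) → HasOrder (powℕ g k) m
  powℕ-hasOrder {g} k m (km>0 , gᵏᵐ≈ε , minimal) = >-nonZero⁻¹ m , trans (powℕ-* g k m) gᵏᵐ≈ε , minimalᵏ
    where
      instance
        km≢0 : NonZero (k * m)
        km≢0 = >-nonZero km>0
        k≢0 : NonZero k
        k≢0 = m*n≢0⇒m≢0 k
        m≢0 : NonZero m
        m≢0 = m*n≢0⇒n≢0 k

      minimalᵏ : ∀ j → 0 < j → j < m → ¬ powℕ (powℕ g k) j ≈ ε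
      minimalᵏ j j>0 j<m gᵏʲ≈ε =
        minimal (k * j) (>-nonZero⁻¹ (k * j)) (*-monoʳ-< k j<m) (trans (sym (powℕ-* g k j)) gᵏʲ≈ε)
        where instance
          kj≢0 : NonZero (k * j)
          kj≢0 = m*n≢0 k j {{k≢0}} {{>-nonZero j>0}}

  involution-hasOrder : ∀ {g} → g ∙ g ≈ ε → ¬ g ≈ ε → HasOrder g 2
  involution-hasOrder {g} gg≈ε g≉ε = z<s , trans (∙-congˡ (identityʳ g)) gg≈ε , minimal
    where
      minimal : ∀ j → 0 < j → j < 2 → ¬ powℕ g j ≈ ε
      minimal (suc zero)    _ _ g∙ε≈ε = g≉ε (trans (sym (identityʳ g)) g∙ε≈ε)
      minimal (suc (suc _)) _ (s≤s (s≤s ()))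

  Gen-powℕ : ∀ {g h} n → Gen g h (powℕ g n)
  Gen-powℕ zero    = gen-ε
  Gen-powℕ (suc n) = gen-∙ gen-x (Gen-powℕ n)

  Gen-pow : ∀ {g h} n → Gen g h (pow g n)
  Gen-pow (+ n)    = Gen-powℕ n
  Gen-pow -[1+ n ] = gen-⁻¹ (Gen-powℕ (suc n))

-- Group actions

module GroupAction {c ℓ a} (G : Group c ℓ) {X : Set a} (act : Group.Carrier G → X → X)
    (act-ε : ∀ v → act (Group.ε G) v ≡ v)
    (act-∙ : ∀ g h v → act (Group._∙_ G g h) v ≡ act h (act g v))
    (act-resp : ∀ {g h} → Group._≈_ G g h → ∀ v → act g v ≡ act h v) where
  open Group G using (_∙_; _⁻¹; inverseˡ; inverseʳ)
  open GroupNotions G using (powℕ; pow)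
  open ≡ using (sym; trans)

  act-⁻¹-act : ∀ g v → act (g ⁻¹) (act g v) ≡ v
  act-⁻¹-act g v = trans (sym (act-∙ g (g ⁻¹) v)) (trans (act-resp (inverseʳ g) v) (act-ε v))

  act-act-⁻¹ : ∀ g v → act g (act (g ⁻¹) v) ≡ v
  act-act-⁻¹ g v = trans (sym (act-∙ (g ⁻¹) g v)) (trans (act-resp (inverseˡ g) v) (act-ε v))

  act-injective : ∀ g {u v} → act g u ≡ act g v → u ≡ v
  act-injective g {u} {v} eq =
    trans (sym (act-⁻¹-act g u)) (trans (cong (act (g ⁻¹)) eq) (act-⁻¹-act g v))

  fixes-⁻¹ : ∀ {g v} → act g v ≡ v → act (g ⁻¹) v ≡ v
  fixes-⁻¹ {g} {v} gv≡v = trans (cong (act (g ⁻¹)) (sym gv≡v)) (act-⁻¹-act g v)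

  fixes-powℕ : ∀ {g v} → act g v ≡ v → ∀ n → act (powℕ g n) v ≡ v
  fixes-powℕ         gv≡v zero    = act-ε _
  fixes-powℕ {g} {v} gv≡v (suc n) =
    trans (act-∙ g (powℕ g n) v) (trans (cong (act (powℕ g n)) gv≡v) (fixes-powℕ gv≡v n))

  fixes-pow : ∀ {g v} → act g v ≡ v → ∀ n → act (pow g n) v ≡ v
  fixes-pow gv≡v (+ n)    = fixes-powℕ gv≡v n
  fixes-pow gv≡v -[1+ n ] = fixes-⁻¹ (fixes-powℕ gv≡v (suc n))

  act-powℕ : ∀ g n v → act (powℕ g n) v ≡ iterate (act g) n v
  act-powℕ g zero    v = act-ε v
  act-powℕ g (suc n) v = trans (act-∙ g (powℕ g n) v) (act-powℕ g n (act g v))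

  act≡act⇔fixes : ∀ g h v → (act g v ≡ act h v) ⇔ (act (g ∙ h ⁻¹) v ≡ v)
  act≡act⇔fixes g h v = mk⇔
    (λ eq → trans (act-∙ g (h ⁻¹) v) (trans (cong (act (h ⁻¹)) eq) (act-⁻¹-act h v)))
    (λ eq → trans (sym (act-act-⁻¹ h (act g v)))
              (cong (act h) (trans (sym (act-∙ g (h ⁻¹) v)) eq)))

-- Incidence in a graph

module Incidence {a} (Γ : Graph a) where
  open Graph Γ
  open GraphNotions Γ
  open ≡ using (sym; trans)

  private
    module _ {p q : V} where

      either-unique : ∀ {v u w} → v ≡ p ⊎ v ≡ q → u ≡ p ⊎ u ≡ q → w ≡ p ⊎ w ≡ q →
                      ¬ v ≡ u → ¬ v ≡ w → u ≡ w
      either-unique _          (inj₁ u≡p) (inj₁ w≡p) _   _   = trans u≡p (sym w≡p)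
      either-unique _          (inj₂ u≡q) (inj₂ w≡q) _   _   = trans u≡q (sym w≡q)
      either-unique (inj₁ v≡p) (inj₁ u≡p) (inj₂ _)   v≢u _   = ⊥-elim (v≢u (trans v≡p (sym u≡p)))
      either-unique (inj₂ v≡q) (inj₁ _)   (inj₂ w≡q) _   v≢w = ⊥-elim (v≢w (trans v≡q (sym w≡q)))
      either-unique (inj₁ v≡p) (inj₂ _)   (inj₁ w≡p) _   v≢w = ⊥-elim (v≢w (trans v≡p (sym w≡p)))
      either-unique (inj₂ v≡q) (inj₂ u≡q) (inj₁ _)   v≢u _   = ⊥-elim (v≢u (trans v≡q (sym u≡q)))

      either-≡-or-≢ : ¬ p ≡ q → ∀ {u w} → u ≡ p ⊎ u ≡ q → w ≡ p ⊎ w ≡ q → u ≡ w ⊎ ¬ u ≡ w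
      either-≡-or-≢ _   (inj₁ u≡p) (inj₁ w≡p) = inj₁ (trans u≡p (sym w≡p))
      either-≡-or-≢ _   (inj₂ u≡q) (inj₂ w≡q) = inj₁ (trans u≡q (sym w≡q))
      either-≡-or-≢ p≢q (inj₁ u≡p) (inj₂ w≡q) = inj₂ λ u≡w → p≢q (trans (sym u≡p) (trans u≡w w≡q))
      either-≡-or-≢ p≢q (inj₂ u≡q) (inj₁ w≡p) = inj₂ λ u≡w → p≢q (trans (sym w≡p) (trans (sym u≡w) u≡q))

  some-end : ∀ f → ∃[ u ] I u f
  some-end f = let (u , _ , _ , Iuf , _) = two-ends f in u , Iuf

  other-end : ∀ {v f} → I v f → ∃[ w ] (¬ v ≡ w × I w f)
  other-end {v} {f} Ivf with two-ends f
  ... | u , w , u≢w , Iuf , Iwf , ends with ends v Ivf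
  ...   | inj₁ v≡u = w , (λ v≡w → u≢w (trans (sym v≡u) v≡w)) , Iwf
  ...   | inj₂ v≡w = u , (λ v≡u → u≢w (trans (sym v≡u) v≡w)) , Iuf

  other-end-unique : ∀ {v u w f} → I v f → I u f → I w f → ¬ v ≡ u → ¬ v ≡ w → u ≡ w
  other-end-unique {v} {u} {w} {f} Ivf Iuf Iwf with two-ends f
  ... | _ , _ , _ , _ , _ , ends = either-unique (ends v Ivf) (ends u Iuf) (ends w Iwf)

  incident-≡-or-≢ : ∀ {u w f} → I u f → I w f → u ≡ w ⊎ ¬ u ≡ w
  incident-≡-or-≢ {u} {w} {f} Iuf Iwf with two-ends f
  ... | _ , _ , p≢q , _ , _ , ends = either-≡-or-≢ p≢q (ends u Iuf) (ends w Iwf)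

  incident⇒end : ∀ {u w y f} → ¬ u ≡ w → I u f → I w f → I y f → y ≡ u ⊎ y ≡ w
  incident⇒end u≢w Iuf Iwf Iyf with incident-≡-or-≢ Iyf Iuf
  ... | inj₁ y≡u = inj₁ y≡u
  ... | inj₂ y≢u = inj₂ (other-end-unique Iuf Iyf Iwf (λ u≡y → y≢u (sym u≡y)) u≢w)

  module _ {k m} (valency : HasValency k) (multiplicity : HasEdgeMultiplicity m) (α : V) where

    private
      neighbour : Fin k → V
      neighbour = proj₁ (valency α)

      neighbour-injective : Injective _≡_ _≡_ neighbour
      neighbour-injective = proj₁ (proj₂ (valency α))

      adjacent : ∀ i → Adjacent α (neighbour i)
      adjacent i = from (proj₂ (proj₂ (valency α)) (neighbour i)) (i , ≡.refl)

      common : ∀ i → HasSize (λ f → I α f × I (neighbour i) f) m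
      common i = multiplicity α (neighbour i) (adjacent i)

      edge : Fin k → Fin m → E
      edge i = proj₁ (common i)

      edge-incident : ∀ i j → I α (edge i j) × I (neighbour i) (edge i j)
      edge-incident i j = from (proj₂ (proj₂ (common i)) (edge i j)) (j , ≡.refl)

      edge-injective : ∀ {i j i′ j′} → edge i j ≡ edge i′ j′ → (i , j) ≡ (i′ , j′)
      edge-injective {i} {j} {i′} {j′} eq
        with neighbour-injective (other-end-unique (proj₁ (edge-incident i j)) (proj₂ (edge-incident i j))
               (subst (I (neighbour i′)) (sym eq) (proj₂ (edge-incident i′ j′)))
               (proj₁ (adjacent i)) (proj₁ (adjacent i′)))
      ... | ≡.refl = cong (i ,_) (proj₁ (proj₂ (common i)) eq)

      edge-surjective : ∀ {f} → I α f → ∃[ i ] ∃[ j ] edge i j ≡ f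
      edge-surjective {f} Iαf with other-end Iαf
      ... | w , α≢w , Iwf with to (proj₂ (proj₂ (valency α)) w) (α≢w , f , Iαf , Iwf)
      ...   | i , neighbour≡w
        with to (proj₂ (proj₂ (common i)) f) (Iαf , subst (λ u → I u f) (sym neighbour≡w) Iwf)
      ...     | j , edge≡f = i , j , edge≡f

      enum : Fin (k * m) → E
      enum c = uncurry edge (remQuot {k} m c)

      enum-injective : Injective _≡_ _≡_ enum
      enum-injective {c} {c′} eq = begin
        c                                   ≡⟨ combine-remQuot {k} m c ⟨
        uncurry combine (remQuot {k} m c)   ≡⟨ cong (uncurry combine) (edge-injective eq) ⟩
        uncurry combine (remQuot {k} m c′)  ≡⟨ combine-remQuot {k} m c′ ⟩
        c′                                  ∎
        where open ≡.≡-Reasoning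

      enum-surjective : ∀ {f} → I α f → ∃[ c ] enum c ≡ f
      enum-surjective Iαf with edge-surjective Iαf
      ... | i , j , edge≡f = combine i j , trans (cong (uncurry edge) (remQuot-combine i j)) edge≡f

    incident-edges-hasSize : HasSize (I α) (k * m)
    incident-edges-hasSize = enum , enum-injective , λ f → mk⇔ enum-surjective
      λ (c , enum≡f) → subst (I α) enum≡f (proj₁ (uncurry edge-incident (remQuot {k} m c)))

-- Vertex-rotary actions

module VertexRotaryAction {a c ℓ} {Γ : Graph a} {G : Group c ℓ} (A : AutAction G Γ)
    (connected : GraphNotions.IsConnected Γ) (rotary : ActionNotions.VertexRotary A) where
  open Graph Γ
  open GraphNotions Γ
  open Group G renaming (sym to ≈-sym; trans to ≈-trans)
  open GroupNotions G
  open GroupPowers G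
  open AutAction A
  open ActionNotions A
  open Incidence Γ
  open import Algebra.Properties.Group G using (x∙y⁻¹≈ε⇒x≈y; //-rightDividesˡ)
  module ActV = GroupAction G actV actV-ε actV-∙ actV-resp
  module ActE = GroupAction G actE actE-ε actE-∙ actE-resp

  act-incident : ∀ g {v f} → I v f → I (actV g v) (actE g f)
  act-incident g {v} {f} = to (preserves-I g v f)

  arc-transitive : ArcTransitive
  arc-transitive = proj₁ rotary

  FixesStar : V → Carrier → Set a
  FixesStar v g = actV g v ≡ v × (∀ f → I v f → actE g f ≡ f)

  -- G_v acts on E(v) through a transitive cyclic group, which, being abelian, is regular.
  fixes-flag⇒fixes-star : ∀ {v f g} → actV g v ≡ v → I v f → actE g f ≡ f → FixesStar v g
  fixes-flag⇒fixes-star {v} {f} {g} gv≡v Ivf gf≡f = gv≡v , fixes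
    where
      open ≡.≡-Reasoning
      fixes : ∀ f′ → I v f′ → actE g f′ ≡ f′
      fixes f′ Ivf′ with proj₁ (proj₂ rotary v) | proj₂ (proj₂ rotary v) f f′ Ivf Ivf′
      ... | h , _ , local | g′ , g′v≡v , g′f≡f′ with local g gv≡v | local g′ g′v≡v
      ... | n , g-acts | n′ , g′-acts = begin
        actE g f′                            ≡⟨ g-acts f′ Ivf′ ⟩
        actE (pow h n) f′                    ≡⟨ cong (actE (pow h n)) f′≡hⁿ′f ⟩
        actE (pow h n) (actE (pow h n′) f)   ≡⟨ actE-∙ (pow h n′) (pow h n) f ⟨
        actE (pow h n′ ∙ pow h n) f          ≡⟨ actE-resp (pow-commute h n′ n) f ⟩
        actE (pow h n ∙ pow h n′) f          ≡⟨ actE-∙ (pow h n) (pow h n′) f ⟩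
        actE (pow h n′) (actE (pow h n) f)   ≡⟨ cong (actE (pow h n′)) (g-acts f Ivf) ⟨
        actE (pow h n′) (actE g f)           ≡⟨ cong (actE (pow h n′)) gf≡f ⟩
        actE (pow h n′) f                    ≡⟨ f′≡hⁿ′f ⟨
        f′                                   ∎
        where
          f′≡hⁿ′f : f′ ≡ actE (pow h n′) f
          f′≡hⁿ′f = ≡.trans (≡.sym g′f≡f′) (g′-acts f Ivf)

  fixes-star-neighbour : ∀ {u w f g} → FixesStar u g → I u f → I w f → FixesStar w g
  fixes-star-neighbour {u} {w} {f} {g} fixes-u Iuf Iwf with incident-≡-or-≢ Iuf Iwf
  ... | inj₁ ≡.refl = fixes-u
  ... | inj₂ u≢w    = fixes-flag⇒fixes-star gw≡w Iwf gf≡f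
    where
      gf≡f : actE g f ≡ f
      gf≡f = proj₂ fixes-u f Iuf
      gw≡w : actV g w ≡ w
      gw≡w = other-end-unique Iuf (subst (I (actV g w)) gf≡f (act-incident g Iwf)) Iwf
        (λ u≡gw → u≢w (ActV.act-injective g (≡.trans (proj₁ fixes-u) u≡gw))) u≢w

  fixes-star-walk : ∀ {u w g} → Connected u w → FixesStar u g → FixesStar w g
  fixes-star-walk here                fixes-u = fixes-u
  fixes-star-walk (step Iuf Iu′f walk) fixes-u =
    fixes-star-walk walk (fixes-star-neighbour fixes-u Iuf Iu′f)

  fixes-star⇒≈ε : ∀ {v g} → FixesStar v g → g ≈ ε
  fixes-star⇒≈ε {v} {g} fixes-v = faithful g
    (λ u → proj₁ (fixes-star-walk (connected v u) fixes-v))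
    (λ f → let (u , Iuf) = some-end f in proj₂ (fixes-star-walk (connected v u) fixes-v) f Iuf)

  flag-stabiliser-trivial : ∀ {v f g} → actV g v ≡ v → I v f → actE g f ≡ f → g ≈ ε
  flag-stabiliser-trivial gv≡v Ivf gf≡f = fixes-star⇒≈ε (fixes-flag⇒fixes-star gv≡v Ivf gf≡f)

  flag-determines : ∀ {v f g h} → I v f → actV g v ≡ actV h v → actE g f ≡ actE h f → g ≈ h
  flag-determines {v} {f} {g} {h} Ivf gv≡hv gf≡hf = x∙y⁻¹≈ε⇒x≈y g h (flag-stabiliser-trivial
    (to (ActV.act≡act⇔fixes g h v) gv≡hv) Ivf (to (ActE.act≡act⇔fixes g h f) gf≡hf))

  arc-regular : ArcRegular
  arc-regular = arc-transitive ,
    λ arc g (ge≡e , gt≡t , _) → flag-stabiliser-trivial gt≡t (Arc.tail-inc arc) ge≡e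

  module Flag {α β : V} {e : E} (α≢β : ¬ α ≡ β) (Iαe : I α e) (Iβe : I β e) where

    H J : Carrier → Set a
    H g = actV g α ≡ α
    J g = actE g e ≡ e

    x : Carrier
    x = proj₁ (proj₁ (proj₂ rotary α))

    x∈H : H x
    x∈H = proj₁ (proj₂ (proj₁ (proj₂ rotary α)))

    H-acts-by-powers : ∀ g → H g → ∃[ n ] (∀ f → I α f → actE g f ≡ actE (pow x n) f)
    H-acts-by-powers = proj₂ (proj₂ (proj₁ (proj₂ rotary α)))

    H-transitive : ∀ f f′ → I α f → I α f′ → ∃[ g ] (H g × actE g f ≡ f′)
    H-transitive = proj₂ (proj₂ rotary α)

    H⊆⟨x⟩ : ∀ {g} → H g → Cyc x g
    H⊆⟨x⟩ {g} gα≡α with H-acts-by-powers g gα≡α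
    ... | n , g-acts =
      n , flag-determines Iαe (≡.trans gα≡α (≡.sym (ActV.fixes-pow x∈H n))) (g-acts e Iαe)

    ⟨x⟩⊆H : ∀ {g} → Cyc x g → H g
    ⟨x⟩⊆H (n , g≈xⁿ) = ≡.trans (actV-resp g≈xⁿ α) (ActV.fixes-pow x∈H n)

    H⇔⟨x⟩ : ∀ g → H g ⇔ Cyc x g
    H⇔⟨x⟩ g = mk⇔ H⊆⟨x⟩ ⟨x⟩⊆H

    neighbour∈Hβ : ∀ {u f} → ¬ α ≡ u → I α f → I u f → ∃[ g ] (H g × actV g β ≡ u)
    neighbour∈Hβ {u} {f} α≢u Iαf Iuf with H-transitive e f Iαe Iαf
    ... | g , gα≡α , ge≡f = g , gα≡α , other-end-unique Iαf Igβf Iuf α≢gβ α≢u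
      where
        Igβf : I (actV g β) f
        Igβf = subst (I (actV g β)) ge≡f (act-incident g Iβe)
        α≢gβ : ¬ α ≡ actV g β
        α≢gβ α≡gβ = α≢β (ActV.act-injective g (≡.trans gα≡α α≡gβ))

    arc-αβ arc-βα : Arc
    arc-αβ = record { edge = e ; tail = α ; head = β ; distinct = α≢β
                    ; tail-inc = Iαe ; head-inc = Iβe }
    arc-βα = record { edge = e ; tail = β ; head = α ; distinct = λ β≡α → α≢β (≡.sym β≡α)
                    ; tail-inc = Iβe ; head-inc = Iαe }

    z : Carrier
    z = proj₁ (arc-transitive arc-αβ arc-βα)

    z∈J : J z
    z∈J = proj₁ (proj₂ (arc-transitive arc-αβ arc-βα))

    zα≡β : actV z α ≡ β
    zα≡β = proj₁ (proj₂ (proj₂ (arc-transitive arc-αβ arc-βα)))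

    zβ≡α : actV z β ≡ α
    zβ≡α = proj₂ (proj₂ (proj₂ (arc-transitive arc-αβ arc-βα)))

    order-z : HasOrder z 2
    order-z = involution-hasOrder zz≈ε z≉ε
      where
        zz≈ε : z ∙ z ≈ ε
        zz≈ε = flag-stabiliser-trivial (≡.trans (actV-∙ z z α) (≡.trans (cong (actV z) zα≡β) zβ≡α)) Iαe
                 (≡.trans (actE-∙ z z e) (≡.trans (cong (actE z) z∈J) z∈J))
        z≉ε : ¬ z ≈ ε
        z≉ε z≈ε = α≢β (≡.trans (≡.sym (≡.trans (actV-resp z≈ε α) (actV-ε α))) zα≡β)

    J⇔⟨z⟩ : ∀ g → J g ⇔ Cyc z g
    J⇔⟨z⟩ g = mk⇔ J⊆⟨z⟩ λ (n , g≈zⁿ) → ≡.trans (actE-resp g≈zⁿ e) (ActE.fixes-pow z∈J n)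
      where
        J⊆⟨z⟩ : J g → Cyc z g
        J⊆⟨z⟩ ge≡e with incident⇒end α≢β Iαe Iβe (subst (I (actV g α)) ge≡e (act-incident g Iαe))
        ... | inj₁ gα≡α = + 0 ,
          flag-determines Iαe (≡.trans gα≡α (≡.sym (actV-ε α))) (≡.trans ge≡e (≡.sym (actE-ε e)))
        ... | inj₂ gα≡β = + 1 , ≈-trans
          (flag-determines Iαe (≡.trans gα≡β (≡.sym zα≡β)) (≡.trans ge≡e (≡.sym z∈J))) (≈-sym (identityʳ z))

    H∩J-trivial : ∀ g → H g → J g → g ≈ ε
    H∩J-trivial g gα≡α ge≡e = flag-stabiliser-trivial gα≡α Iαe ge≡e

    z∉⟨x⟩ : ¬ Cyc x z
    z∉⟨x⟩ z∈⟨x⟩ = α≢β (≡.trans (≡.sym (⟨x⟩⊆H z∈⟨x⟩)) zα≡β)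

    zˣ∉⟨x⟩ : ¬ Cyc x (x ⁻¹ ∙ z ∙ x)
    zˣ∉⟨x⟩ zˣ∈⟨x⟩ = α≢β (≡.sym (ActV.act-injective x (≡.trans xβ≡α (≡.sym x∈H))))
      where
        open ≡.≡-Reasoning
        xβ≡α : actV x β ≡ α
        xβ≡α = begin
          actV x β                                ≡⟨ cong (actV x) zα≡β ⟨
          actV x (actV z α)                       ≡⟨ cong (λ v → actV x (actV z v)) (ActV.fixes-⁻¹ x∈H) ⟨
          actV x (actV z (actV (x ⁻¹) α))         ≡⟨ cong (actV x) (actV-∙ (x ⁻¹) z α) ⟨
          actV x (actV (x ⁻¹ ∙ z) α)              ≡⟨ actV-∙ (x ⁻¹ ∙ z) x α ⟨
          actV (x ⁻¹ ∙ z ∙ x) α                   ≡⟨ ⟨x⟩⊆H zˣ∈⟨x⟩ ⟩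
          α                                       ∎

    conjugate∈H⇔fixes-β : ∀ g → H (z ∙ g ∙ z ⁻¹) ⇔ (actV g β ≡ β)
    conjugate∈H⇔fixes-β g = mk⇔
      (λ gᶻα≡α → ≡.trans (≡.sym (ActV.act-act-⁻¹ z (actV g β)))
                   (≡.trans (cong (actV z) (≡.trans (≡.sym conj) gᶻα≡α)) zα≡β))
      (λ gβ≡β → ≡.trans conj
                  (≡.trans (cong (actV (z ⁻¹)) (≡.trans gβ≡β (≡.sym zα≡β))) (ActV.act-⁻¹-act z α)))
      where
        conj : actV (z ∙ g ∙ z ⁻¹) α ≡ actV (z ⁻¹) (actV g β)
        conj = ≡.trans (actV-∙ (z ∙ g) (z ⁻¹) α)
                 (cong (actV (z ⁻¹)) (≡.trans (actV-∙ z g α) (cong (actV g) zα≡β)))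

    Reachable : V → Set (a ⊔ c ⊔ ℓ)
    Reachable v = ∃[ w ] (Gen x z w × actV w α ≡ v)

    H⊆⟨x,z⟩ : ∀ {g} → H g → Gen x z g
    H⊆⟨x,z⟩ gα≡α with H⊆⟨x⟩ gα≡α
    ... | n , g≈xⁿ = gen-≈ (≈-sym g≈xⁿ) (Gen-pow n)

    neighbour-reachable : ∀ {u f} → ¬ α ≡ u → I α f → I u f → Reachable u
    neighbour-reachable α≢u Iαf Iuf with neighbour∈Hβ α≢u Iαf Iuf
    ... | g , gα≡α , gβ≡u =
      z ∙ g , gen-∙ gen-y (H⊆⟨x,z⟩ gα≡α) , ≡.trans (actV-∙ z g α) (≡.trans (cong (actV g) zα≡β) gβ≡u)

    reachable-step : ∀ {u w f} → I u f → I w f → Reachable w → Reachable u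
    reachable-step {u} {w} {f} Iuf Iwf (t , t∈⟨x,z⟩ , tα≡w) with incident-≡-or-≢ Iuf Iwf
    ... | inj₁ u≡w = t , t∈⟨x,z⟩ , ≡.trans tα≡w (≡.sym u≡w)
    ... | inj₂ u≢w with neighbour-reachable α≢t⁻¹u Iαt⁻¹f (act-incident (t ⁻¹) Iuf)
      where
        t⁻¹w≡α : actV (t ⁻¹) w ≡ α
        t⁻¹w≡α = ≡.trans (cong (actV (t ⁻¹)) (≡.sym tα≡w)) (ActV.act-⁻¹-act t α)
        Iαt⁻¹f : I α (actE (t ⁻¹) f)
        Iαt⁻¹f = subst (λ v → I v (actE (t ⁻¹) f)) t⁻¹w≡α (act-incident (t ⁻¹) Iwf)
        α≢t⁻¹u : ¬ α ≡ actV (t ⁻¹) u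
        α≢t⁻¹u α≡t⁻¹u = u≢w (≡.sym (≡.trans (≡.sym tα≡w)
                          (≡.trans (cong (actV t) α≡t⁻¹u) (ActV.act-act-⁻¹ t u))))
    ...   | s , s∈⟨x,z⟩ , sα≡t⁻¹u = s ∙ t , gen-∙ s∈⟨x,z⟩ t∈⟨x,z⟩ ,
            ≡.trans (actV-∙ s t α) (≡.trans (cong (actV t) sα≡t⁻¹u) (ActV.act-act-⁻¹ t u))

    reachable-walk : ∀ {u w} → Connected u w → Reachable w → Reachable u
    reachable-walk here                w-reachable = w-reachable
    reachable-walk (step Iuf Iu′f walk) w-reachable =
      reachable-step Iuf Iu′f (reachable-walk walk w-reachable)

    ⟨x,z⟩-transitive : ∀ v → Reachable v
    ⟨x,z⟩-transitive v = reachable-walk (connected v α) (ε , gen-ε , actV-ε α)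

    generates : Generates x z
    generates g with ⟨x,z⟩-transitive (actV g α)
    ... | w , w∈⟨x,z⟩ , wα≡gα = gen-≈ (//-rightDividesˡ w g)
      (gen-∙ (H⊆⟨x,z⟩ (to (ActV.act≡act⇔fixes g w α) (≡.sym wα≡gα))) w∈⟨x,z⟩)

    edge-reachable : ∀ f → ∃[ g ] actE g e ≡ f
    edge-reachable f with some-end f
    ... | u , Iuf with ⟨x,z⟩-transitive u
    ...   | w , _ , wα≡u with H-transitive e (actE (w ⁻¹) f) Iαe Iαw⁻¹f
      where
        w⁻¹u≡α : actV (w ⁻¹) u ≡ α
        w⁻¹u≡α = ≡.trans (cong (actV (w ⁻¹)) (≡.sym wα≡u)) (ActV.act-⁻¹-act w α)
        Iαw⁻¹f : I α (actE (w ⁻¹) f)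
        Iαw⁻¹f = subst (λ v → I v (actE (w ⁻¹) f)) w⁻¹u≡α (act-incident (w ⁻¹) Iuf)
    ...     | h , _ , he≡w⁻¹f = h ∙ w ,
              ≡.trans (actE-∙ h w e) (≡.trans (cong (actE w) he≡w⁻¹f) (ActE.act-act-⁻¹ w f))

    incident⇔∈JH : ∀ g h → I (actV g α) (actE h e) ⇔ Prod J H (h ∙ g ⁻¹)
    incident⇔∈JH g h = mk⇔ incident⇒∈JH ∈JH⇒incident
      where
        incident-at-α : I (actV g α) (actE h e) ⇔ I α (actE (h ∙ g ⁻¹) e)
        incident-at-α = mk⇔
          (λ I′ → subst₂ I (ActV.act-⁻¹-act g α) (≡.sym (actE-∙ h (g ⁻¹) e)) (act-incident (g ⁻¹) I′))
          (λ I′ → subst (I (actV g α))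
                    (≡.trans (≡.sym (actE-∙ (h ∙ g ⁻¹) g e)) (actE-resp (//-rightDividesˡ g h) e))
                    (act-incident g I′))

        incident⇒∈JH : I (actV g α) (actE h e) → Prod J H (h ∙ g ⁻¹)
        incident⇒∈JH I′ with H-transitive e _ Iαe (to incident-at-α I′)
        ... | y , yα≡α , ye≡hg⁻¹e =
          h ∙ g ⁻¹ ∙ y ⁻¹ , y , j∈J , yα≡α , ≈-sym (//-rightDividesˡ y (h ∙ g ⁻¹))
          where
            j∈J : J (h ∙ g ⁻¹ ∙ y ⁻¹)
            j∈J = ≡.trans (actE-∙ (h ∙ g ⁻¹) (y ⁻¹) e)
                    (≡.trans (cong (actE (y ⁻¹)) (≡.sym ye≡hg⁻¹e)) (ActE.act-⁻¹-act y e))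

        ∈JH⇒incident : Prod J H (h ∙ g ⁻¹) → I (actV g α) (actE h e)
        ∈JH⇒incident (j , y , je≡e , yα≡α , hg⁻¹≈jy) = from incident-at-α
          (subst (I α) (≡.sym (≡.trans (actE-resp hg⁻¹≈jy e) (≡.trans (actE-∙ j y e) (cong (actE y) je≡e))))
                 (subst (λ v → I v (actE y e)) yα≡α (act-incident y Iαe)))

    Cos-iso : IsoCos H J
    Cos-iso = (λ g → actV g α) , (λ g → actE g e)
            , (λ g h → ActV.act≡act⇔fixes g h α) , (λ g h → ActE.act≡act⇔fixes g h e)
            , (λ v → let (w , _ , wα≡v) = ⟨x,z⟩-transitive v in w , wα≡v)
            , edge-reachable , incident⇔∈JH

    module Orders {k m} (valency : HasValency k) (multiplicity : HasEdgeMultiplicity m) where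

      x-preserves-edges : ∀ {f} → I α f → I α (actE x f)
      x-preserves-edges {f} Iαf = subst (λ v → I v (actE x f)) x∈H (act-incident x Iαf)

      x-preserves-neighbours : ∀ {u} → Adjacent α u → Adjacent α (actV x u)
      x-preserves-neighbours (α≢u , f , Iαf , Iuf) =
        (λ α≡xu → α≢u (ActV.act-injective x (≡.trans x∈H α≡xu))) ,
        actE x f , x-preserves-edges Iαf , act-incident x Iuf

      module EdgeOrbit = FiniteOrbit (incident-edges-hasSize valency multiplicity α)
        (actE x) (ActE.act-injective x) x-preserves-edges Iαe
      module NeighbourOrbit = FiniteOrbit (valency α)
        (actV x) (ActV.act-injective x) x-preserves-neighbours (α≢β , e , Iαe , Iβe)

      xⁿ≈ε⇔xⁿe≡e : ∀ n → powℕ x n ≈ ε ⇔ iterate (actE x) n e ≡ e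
      xⁿ≈ε⇔xⁿe≡e n = mk⇔
        (λ xⁿ≈ε → ≡.trans (≡.sym (ActE.act-powℕ x n e)) (≡.trans (actE-resp xⁿ≈ε e) (actE-ε e)))
        (λ xⁿe≡e → flag-stabiliser-trivial (ActV.fixes-powℕ x∈H n) Iαe
                     (≡.trans (ActE.act-powℕ x n e) xⁿe≡e))

      -- Needed before |x| is known: it turns the integer powers of x into natural ones.
      x-has-finite-order : ∃[ d ] (d > 0 × powℕ x d ≈ ε)
      x-has-finite-order =
        let (d , d>0 , _ , xᵈe≡e) = EdgeOrbit.return-time in d , d>0 , from (xⁿ≈ε⇔xⁿe≡e d) xᵈe≡e

      H⊆powℕ : ∀ {g} → H g → ∃[ r ] g ≈ powℕ x r
      H⊆powℕ gα≡α =
        let (d , d>0 , xᵈ≈ε) = x-has-finite-order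
            (n , g≈xⁿ)       = H⊆⟨x⟩ gα≡α
            (r , xⁿ≈xʳ)      = pow≈powℕ d>0 xᵈ≈ε n
        in r , ≈-trans g≈xⁿ xⁿ≈xʳ

      edge-reach : ∀ {f} → I α f → ∃[ r ] iterate (actE x) r e ≡ f
      edge-reach {f} Iαf =
        let (g , gα≡α , ge≡f) = H-transitive e f Iαe Iαf
            (r , g≈xʳ)        = H⊆powℕ gα≡α
        in r , ≡.trans (≡.sym (ActE.act-powℕ x r e)) (≡.trans (actE-resp (≈-sym g≈xʳ) e) ge≡f)

      neighbour-reach : ∀ {u} → Adjacent α u → ∃[ r ] iterate (actV x) r β ≡ u
      neighbour-reach (α≢u , f , Iαf , Iuf) =
        let (g , gα≡α , gβ≡u) = neighbour∈Hβ α≢u Iαf Iuf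
            (r , g≈xʳ)        = H⊆powℕ gα≡α
        in r , ≡.trans (≡.sym (ActV.act-powℕ x r β)) (≡.trans (actV-resp (≈-sym g≈xʳ) β) gβ≡u)

      open EdgeOrbit.Transitive edge-reach
        renaming (orbit-period to edge-period; orbit-aperiodic to edge-aperiodic) using ()
      open NeighbourOrbit.Transitive neighbour-reach
        renaming (orbit-period to neighbour-period; period-divides to neighbour-period-divides) using ()

      order-x : HasOrder x (k * m)
      order-x = EdgeOrbit.size>0 , from (xⁿ≈ε⇔xⁿe≡e (k * m)) edge-period ,
        λ j j>0 j<km xʲ≈ε → edge-aperiodic j>0 j<km (to (xⁿ≈ε⇔xⁿe≡e j) xʲ≈ε)

      order-xᵏ : HasOrder (powℕ x k) m
      order-xᵏ = powℕ-hasOrder k m order-x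

      xᵏβ≡β : actV (powℕ x k) β ≡ β
      xᵏβ≡β = ≡.trans (ActV.act-powℕ x k β) neighbour-period

      Gαβ⇔⟨xᵏ⟩ : ∀ g → (H g × actV g β ≡ β) ⇔ Cyc (powℕ x k) g
      Gαβ⇔⟨xᵏ⟩ g = mk⇔ Gαβ⊆⟨xᵏ⟩ λ (n , g≈xᵏⁿ) →
          ≡.trans (actV-resp g≈xᵏⁿ α) (ActV.fixes-pow (ActV.fixes-powℕ x∈H k) n)
        , ≡.trans (actV-resp g≈xᵏⁿ β) (ActV.fixes-pow xᵏβ≡β n)
        where
          Gαβ⊆⟨xᵏ⟩ : H g × actV g β ≡ β → Cyc (powℕ x k) g
          Gαβ⊆⟨xᵏ⟩ (gα≡α , gβ≡β) =
            let (r , g≈xʳ)      = H⊆powℕ gα≡α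
                divides q r≡q*k = neighbour-period-divides r
                  (≡.trans (≡.sym (ActV.act-powℕ x r β)) (≡.trans (actV-resp (≈-sym g≈xʳ) β) gβ≡β))
            in + q , ≈-trans g≈xʳ
                 (≈-trans (reflexive (cong (powℕ x) (≡.trans r≡q*k (*-comm q k)))) (≈-sym (powℕ-* x k q)))

      H∩Hᶻ⇔⟨xᵏ⟩ : ∀ g → (H g × H (z ∙ g ∙ z ⁻¹)) ⇔ Cyc (powℕ x k) g
      H∩Hᶻ⇔⟨xᵏ⟩ g = mk⇔
        (λ (gα≡α , gᶻα≡α) → to (Gαβ⇔⟨xᵏ⟩ g) (gα≡α , to (conjugate∈H⇔fixes-β g) gᶻα≡α))
        (λ g∈⟨xᵏ⟩ → let (gα≡α , gβ≡β) = from (Gαβ⇔⟨xᵏ⟩ g) g∈⟨xᵏ⟩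
                    in gα≡α , from (conjugate∈H⇔fixes-β g) gβ≡β)

lemma3p1 : ∀ {a c ℓ : Level} (Γ : Graph a) (G : Group c ℓ) (A : AutAction G Γ)
    → GraphNotions.IsConnected Γ
    → GraphNotions.LocallyFinite Γ
    → (k m : ℕ)
    → ActionNotions.VertexRotary A
    → GraphNotions.HasValency Γ k
    → GraphNotions.HasEdgeMultiplicity Γ m
    → (α β : Graph.V Γ) (e : Graph.E Γ)
    → ¬ α ≡ β → Graph.I Γ α e → Graph.I Γ β e
    → let open Group G
          open GroupNotions G
          open AutAction A
          H = λ g → actV g α ≡ α
          J = λ g → actE g e ≡ e
      in ActionNotions.IsoCos A H J
         × ∃[ x ] ∃[ z ]
             ( Generates x z
             × (∀ g → H g ⇔ Cyc x g)
             × HasOrder x (k * m)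
             × (∀ g → (H g × H (z ∙ g ∙ z ⁻¹)) ⇔ Cyc (powℕ x k) g)
             × HasOrder (powℕ x k) m
             × (∀ g → J g ⇔ Cyc z g)
             × HasOrder z 2
             × (∀ g → H g → J g → g ≈ ε)
             × ¬ Cyc x z
             × ¬ Cyc x (x ⁻¹ ∙ z ∙ x)
             × RotaryPair x z
             × ActionNotions.ArcRegular A )
lemma3p1 Γ G A connected _ k m rotary valency multiplicity α β e α≢β Iαe Iβe =
    Cos-iso , x , z , generates , H⇔⟨x⟩ , order-x , H∩Hᶻ⇔⟨xᵏ⟩ , order-xᵏ , J⇔⟨z⟩ , order-z
  , H∩J-trivial , z∉⟨x⟩ , zˣ∉⟨x⟩ , ((k * m , order-x) , order-z , z∉⟨x⟩ , generates) , arc-regular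
  where
    open VertexRotaryAction A connected rotary
    open Flag α≢β Iαe Iβe
    open Orders valency multiplicity
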